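{- Let $\Gamma$ and $\Delta$ be multisets of normalized formulas, and let $A_1,\dots,A_k$ and $B_1,\dots,B_m$ be formulas built from the constant $\bot$ by the connectives $\otimes,\multimap$; in addition, some $A_i$ is allowed to be of the form $E_{Y_1}\oplus E_{Y_2}$ for simple products $Y_1,Y_2$. If a sequent $$ A_1,\dots,A_k,\ F_\Gamma,\ !F_\Delta\ \vdash\ B_1,\dots,B_m $$ is derivable in Linear Logic, then $$ \sum_{i=1}^k \#_\bot(A_i)\equiv 1-m+\sum_{j=1}^m\#_\bot(B_j)\pmod{9N}. $$ In particular, for empty right-hand side ($m=0$), $\sum_{i=1}^k\#_\bot(A_i)\equiv 1\pmod{9N}$.
   Context: Derivability is in the standard two-sided sequent calculus of propositional Linear Logic (multiset sequents, possibly several or no formulas on the right). Fix an integer $N$; all literals are among $p_1,\dots,p_{N-7}$, one of which is a distinguished literal $p$. A simple product is a tensor product of $\ge1$ literals. Normalized formulas: $X\multimap Y$, $X\multimap(Y_1\oplus Y_2)$, $(X_1\multimap Y_1)\&(X_2\multimap Y_2)$, $(U\multimap V)\multimap Y$ with all letters simple products. $A^{(n)}=A\otimes\cdots\otimes A$ ($n$ times), $A^{(0)}=\mathbf{1}$. $H_{00}=\bot^{(N+2)}\multimap\bot^{(2)}$, $C_{00}=(H_{00}^{(2)}\multimap\bot^{(3)})\multimap\bot^{(3)}$, $H_1=C_{00}^{(4)}\multimap\bot^{(N)}$, $D_{p_m}=(H_1\multimap\bot^{(m+4)})\multimap\bot^{(m+4)}$, $D_{q_1\otimes\cdots\otimes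 q_n}=D_{q_1}\otimes\cdots\otimes D_{q_n}$, $E_X=C_{00}^{(6)}\otimes D_X$; $F_{X\multimap Y}=E_{p\otimes X}\multimap E_{p\otimes Y}$, $F_Y=E_p\multimap E_{p\otimes Y}$, $F_{(U\multimap V)\multimap Y}=F_{U\multimap V}\multimap F_Y$, $F_{X\multimap(Y_1\oplus Y_2)}=E_{p\otimes X}\multimap(E_{p\otimes Y_1}\oplus E_{p\otimes Y_2})$, $F_{(X_1\multimap Y_1)\&(X_2\multimap Y_2)}=F_{X_1\multimap Y_1}\&F_{X_2\multimap Y_2}$; $F_\Gamma$, $!F_\Delta$ are obtained elementwise. The count $\#_\bot$ is defined by: $\#_\bot(q)=0$ for literals $q$, $\#_\bot(\bot)=1$, $\#_\bot(\mathbf{1})=0$, $\#_\bot(A\otimes B)=\#_\bot(A)+\#_\bot(B)$, $\#_\bot(A\wp B)=\#_\bot(A)+\#_\bot(B)-1$, $\#_\bot(B\multimap A)=\#_\bot(A)-\#_\bot(B)$, $\#_\bot(A\& B)=\min\{\#_\bot(A),\#_\bot(B)\}$, $\#_\bot(A\oplus B)=\max\{\#_\bot(A),\#_\bot(B)\}$. -}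

module Defs where

open import Data.Nat as ℕ using (ℕ; zero; suc; _≤_)
open import Data.Integer as ℤ using (ℤ; +_; _-_)
open import Data.List using (List; []; _∷_; _++_; map; foldr; length)
open import Data.List.NonEmpty using (List⁺; _∷_)
open import Data.List.Relation.Unary.All using (All)
open import Data.List.Relation.Binary.Permutation.Propositional using (_↭_)
open import Data.Product using (_×_; _,_)

infixr 8 _⊗_ _⅋_
infixr 7 _⊕_ _&_
infixr 6 _⊸_
infix 9 !_ ¿_

data Formula : Set where
  lit  : ℕ → Formula
  ⊥′   : Formula
  𝟙    : Formula
  ⊤′   : Formula
  𝟘    : Formula
  _⊗_  : Formula → Formula → Formula
  _⅋_  : Formula → Formula → Formula
  _⊸_  : Formula → Formula → Formula
  _&_  : Formula → Formula → Formula
  _⊕_  : Formula → Formula → Formula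
  !_   : Formula → Formula
  ¿_   : Formula → Formula

-- Two-sided sequent calculus for LL, multiset sequents represented as
-- lists closed under permutation (exchange rule).

infix 2 _⊢_

data _⊢_ : List Formula → List Formula → Set where
  ax    : ∀ {A} → (A ∷ []) ⊢ (A ∷ [])
  cut   : ∀ {Γ Γ′ Δ Δ′ A} → Γ ⊢ A ∷ Δ → A ∷ Γ′ ⊢ Δ′ → Γ ++ Γ′ ⊢ Δ ++ Δ′
  exch  : ∀ {Γ Γ′ Δ Δ′} → Γ ↭ Γ′ → Δ ↭ Δ′ → Γ ⊢ Δ → Γ′ ⊢ Δ′
  ⊥L    : (⊥′ ∷ []) ⊢ []
  ⊥R    : ∀ {Γ Δ} → Γ ⊢ Δ → Γ ⊢ ⊥′ ∷ Δ
  𝟙L    : ∀ {Γ Δ} → Γ ⊢ Δ → 𝟙 ∷ Γ ⊢ Δ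
  𝟙R    : [] ⊢ 𝟙 ∷ []
  ⊤R    : ∀ {Γ Δ} → Γ ⊢ ⊤′ ∷ Δ
  𝟘L    : ∀ {Γ Δ} → 𝟘 ∷ Γ ⊢ Δ
  ⊗L    : ∀ {Γ Δ A B} → A ∷ B ∷ Γ ⊢ Δ → A ⊗ B ∷ Γ ⊢ Δ
  ⊗R    : ∀ {Γ Γ′ Δ Δ′ A B} → Γ ⊢ A ∷ Δ → Γ′ ⊢ B ∷ Δ′ → Γ ++ Γ′ ⊢ A ⊗ B ∷ Δ ++ Δ′
  ⅋L    : ∀ {Γ Γ′ Δ Δ′ A B} → A ∷ Γ ⊢ Δ → B ∷ Γ′ ⊢ Δ′ → A ⅋ B ∷ Γ ++ Γ′ ⊢ Δ ++ Δ′
  ⅋R    : ∀ {Γ Δ A B} → Γ ⊢ A ∷ B ∷ Δ → Γ ⊢ A ⅋ B ∷ Δ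
  ⊸L    : ∀ {Γ Γ′ Δ Δ′ A B} → Γ ⊢ A ∷ Δ → B ∷ Γ′ ⊢ Δ′ → A ⊸ B ∷ Γ ++ Γ′ ⊢ Δ ++ Δ′
  ⊸R    : ∀ {Γ Δ A B} → A ∷ Γ ⊢ B ∷ Δ → Γ ⊢ A ⊸ B ∷ Δ
  &L₁   : ∀ {Γ Δ A B} → A ∷ Γ ⊢ Δ → A & B ∷ Γ ⊢ Δ
  &L₂   : ∀ {Γ Δ A B} → B ∷ Γ ⊢ Δ → A & B ∷ Γ ⊢ Δ
  &R    : ∀ {Γ Δ A B} → Γ ⊢ A ∷ Δ → Γ ⊢ B ∷ Δ → Γ ⊢ A & B ∷ Δ
  ⊕L    : ∀ {Γ Δ A B} → A ∷ Γ ⊢ Δ → B ∷ Γ ⊢ Δ → A ⊕ B ∷ Γ ⊢ Δ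
  ⊕R₁   : ∀ {Γ Δ A B} → Γ ⊢ A ∷ Δ → Γ ⊢ A ⊕ B ∷ Δ
  ⊕R₂   : ∀ {Γ Δ A B} → Γ ⊢ B ∷ Δ → Γ ⊢ A ⊕ B ∷ Δ
  !W    : ∀ {Γ Δ A} → Γ ⊢ Δ → ! A ∷ Γ ⊢ Δ
  !C    : ∀ {Γ Δ A} → ! A ∷ ! A ∷ Γ ⊢ Δ → ! A ∷ Γ ⊢ Δ
  !D    : ∀ {Γ Δ A} → A ∷ Γ ⊢ Δ → ! A ∷ Γ ⊢ Δ
  !R    : ∀ {Γ Δ A} → map !_ Γ ⊢ A ∷ map ¿_ Δ → map !_ Γ ⊢ ! A ∷ map ¿_ Δ
  ¿W    : ∀ {Γ Δ A} → Γ ⊢ Δ → Γ ⊢ ¿ A ∷ Δ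
  ¿C    : ∀ {Γ Δ A} → Γ ⊢ ¿ A ∷ ¿ A ∷ Δ → Γ ⊢ ¿ A ∷ Δ
  ¿D    : ∀ {Γ Δ A} → Γ ⊢ A ∷ Δ → Γ ⊢ ¿ A ∷ Δ
  ¿L    : ∀ {Γ Δ A} → A ∷ map !_ Γ ⊢ map ¿_ Δ → ¿ A ∷ map !_ Γ ⊢ map ¿_ Δ

_^⊗_ : Formula → ℕ → Formula
A ^⊗ zero          = 𝟙
A ^⊗ suc zero      = A
A ^⊗ suc (suc n)   = A ⊗ (A ^⊗ suc n)

-- Simple products: nonempty lists of literal indices  q₁ ⊗ ⋯ ⊗ qₙ
SimpleProduct : Set
SimpleProduct = List⁺ ℕ

⊗ˡ : Formula → List Formula → Formula
⊗ˡ A []       = A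
⊗ˡ A (B ∷ Bs) = A ⊗ ⊗ˡ B Bs

_⊗ₛ_ : ℕ → SimpleProduct → SimpleProduct
p ⊗ₛ (q ∷ qs) = p ∷ (q ∷ qs)

data NormFormula : Set where
  imp    : SimpleProduct → SimpleProduct → NormFormula                    -- X ⊸ Y
  impOr  : SimpleProduct → SimpleProduct → SimpleProduct → NormFormula    -- X ⊸ (Y₁ ⊕ Y₂)
  with2  : SimpleProduct → SimpleProduct → SimpleProduct → SimpleProduct → NormFormula
                                                                          -- (X₁ ⊸ Y₁) & (X₂ ⊸ Y₂)
  impImp : SimpleProduct → SimpleProduct → SimpleProduct → NormFormula    -- (U ⊸ V) ⊸ Y

InRange : ℕ → ℕ → Set
InRange N i = 1 ≤ i × i ℕ.+ 7 ≤ N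

SPInRange : ℕ → SimpleProduct → Set
SPInRange N (q ∷ qs) = InRange N q × All (InRange N) qs

NFInRange : ℕ → NormFormula → Set
NFInRange N (imp X Y)          = SPInRange N X × SPInRange N Y
NFInRange N (impOr X Y₁ Y₂)    = SPInRange N X × SPInRange N Y₁ × SPInRange N Y₂
NFInRange N (with2 X₁ Y₁ X₂ Y₂) =
  SPInRange N X₁ × SPInRange N Y₁ × SPInRange N X₂ × SPInRange N Y₂
NFInRange N (impImp U V Y)     = SPInRange N U × SPInRange N V × SPInRange N Y

module Encoding (N p : ℕ) where

  H₀₀ : Formula
  H₀₀ = (⊥′ ^⊗ (N ℕ.+ 2)) ⊸ (⊥′ ^⊗ 2)

  C₀₀ : Formula
  C₀₀ = ((H₀₀ ^⊗ 2) ⊸ (⊥′ ^⊗ 3)) ⊸ (⊥′ ^⊗ 3)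

  H₁ : Formula
  H₁ = (C₀₀ ^⊗ 4) ⊸ (⊥′ ^⊗ N)

  Dlit : ℕ → Formula
  Dlit m = (H₁ ⊸ (⊥′ ^⊗ (m ℕ.+ 4))) ⊸ (⊥′ ^⊗ (m ℕ.+ 4))

  D : SimpleProduct → Formula
  D (q ∷ qs) = ⊗ˡ (Dlit q) (map Dlit qs)

  E : SimpleProduct → Formula
  E X = (C₀₀ ^⊗ 6) ⊗ D X

  Ep : SimpleProduct → Formula
  Ep X = E (p ⊗ₛ X)

  E₀ : Formula
  E₀ = E (p ∷ [])

  F : NormFormula → Formula
  F (imp X Y)           = Ep X ⊸ Ep Y
  F (impOr X Y₁ Y₂)     = Ep X ⊸ (Ep Y₁ ⊕ Ep Y₂)
  F (with2 X₁ Y₁ X₂ Y₂) = (Ep X₁ ⊸ Ep Y₁) & (Ep X₂ ⊸ Ep Y₂)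
  F (impImp U V Y)      = (Ep U ⊸ Ep V) ⊸ (E₀ ⊸ Ep Y)

data BotFormula : Formula → Set where
  bot : BotFormula ⊥′
  ten : ∀ {A B} → BotFormula A → BotFormula B → BotFormula (A ⊗ B)
  imp : ∀ {A B} → BotFormula A → BotFormula B → BotFormula (A ⊸ B)

-- The count #⊥ (values on ⊤, 0, !, ? are not used; set to 0)

#⊥ : Formula → ℤ
#⊥ (lit _)  = + 0
#⊥ ⊥′       = + 1
#⊥ 𝟙        = + 0
#⊥ ⊤′       = + 0
#⊥ 𝟘        = + 0
#⊥ (A ⊗ B)  = #⊥ A ℤ.+ #⊥ B
#⊥ (A ⅋ B)  = #⊥ A ℤ.+ #⊥ B - + 1
#⊥ (B ⊸ A)  = #⊥ A - #⊥ B
#⊥ (A & B)  = #⊥ A ℤ.⊓ #⊥ B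
#⊥ (A ⊕ B)  = #⊥ A ℤ.⊔ #⊥ B
#⊥ (! _)    = + 0
#⊥ (¿ _)    = + 0

Σ#⊥ : List Formula → ℤ
Σ#⊥ = foldr (λ A s → #⊥ A ℤ.+ s) (+ 0)

-- Interpret linear logic in the phase space of the group ℤ/M with ⊥ = {1}.  Its facts are
-- ∅, the whole group and the singletons, so products, orthogonals (⟨ a ⟩ᗮ = ⟨ 1 - a ⟩) and
-- intersections of facts are explicit, !A is A ∩ {0}, and a derivable sequent Γ ⊢ Δ satisfies
-- ∏⟦Γ⟧ · ∏⟦Δ⟧ᗮ ⊆ ⊥.  A formula built from ⊥ and 1 by ⊗ and ⊸ denotes the singleton of its
-- #⊥ count.  For M = 9N we have #⊥ H₁ = 9N ≡ 0, hence every D_X counts 0 and all E_X denote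
-- one and the same point; so every F_G and !F_G denotes the unit ⟨ 0 ⟩, and E_{Y₁} ⊕ E_{Y₂}
-- denotes its count.  The singleton denoted by the whole sequent then lies in ⊥, which is the
-- claimed congruence.

module Submission where

open import Defs
open import Data.Nat as ℕ using (ℕ; _≤_)
open import Data.Integer as ℤ using (+_; _-_)
open import Data.Integer.Divisibility using (_∣_)
open import Data.List using (List; []; _∷_; _++_; map; length)
open import Data.List.Relation.Unary.All using (All)
open import Data.Product using (_×_; _,_)

open import Data.Nat using (zero; suc)
open import Data.Integer using (ℤ; _+_; -_; _*_; _⊔_; 0ℤ; 1ℤ)
open import Data.Integer.Properties
  using ( +-inverseʳ; +-comm; +-assoc; +-identityˡ; +-identityʳ; ⊔-sel
        ; *-identityˡ; *-identityʳ; *-distribʳ-+; pos-+; pos-*)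
open import Data.Integer.Divisibility.Signed as ∣ₛ
  using (divides; ∣m∣n⇒∣m+n; ∣m⇒∣-m; ∣⇒∣ᵤ) renaming (_∣_ to _∣ₛ_)
open import Data.Integer.Tactic.RingSolver using (solve; solve-∀)
import Data.List.NonEmpty as List⁺
open import Data.List using (foldr)
open import Data.List.Properties using (map-++; ++-assoc)
-- All's constructors stay qualified: overloading [] and _∷_ makes the variable lists passed
-- to the ring solver ambiguous, and elaboration becomes very slow.
import Data.List.Relation.Unary.All as All
open import Data.List.Relation.Unary.All.Properties using (++⁺; map⁺)
open import Data.List.Relation.Binary.Permutation.Propositional as ↭ using (_↭_)
import Data.List.Relation.Binary.Permutation.Propositional.Properties as ↭
open import Data.Sum using (inj₁; inj₂)
open import Function using (_∘_)
open import Level using (0ℓ)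
open import Relation.Binary.Bundles using (Setoid)
open import Relation.Binary.PropositionalEquality
  using (_≡_; refl; sym; trans; subst; cong; cong₂; module ≡-Reasoning)
import Relation.Binary.Reasoning.Setoid
open import Relation.Nullary using (Dec; yes; no; contradiction)
import Relation.Nullary.Decidable as Dec

data IsConstant : Formula → Set where
  ⊥ᶜ   : IsConstant ⊥′
  𝟙ᶜ   : IsConstant 𝟙
  _⊗ᶜ_ : ∀ {A B} → IsConstant A → IsConstant B → IsConstant (A ⊗ B)
  _⊸ᶜ_ : ∀ {A B} → IsConstant A → IsConstant B → IsConstant (A ⊸ B)

BotFormula⇒IsConstant : ∀ {A} → BotFormula A → IsConstant A
BotFormula⇒IsConstant bot       = ⊥ᶜ
BotFormula⇒IsConstant (ten a b) = BotFormula⇒IsConstant a ⊗ᶜ BotFormula⇒IsConstant b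
BotFormula⇒IsConstant (imp a b) = BotFormula⇒IsConstant a ⊸ᶜ BotFormula⇒IsConstant b

module Congruence (M : ℤ) where

  infix 4 _≈_
  -- A record rather than a definition, so that a and b can be inferred from a proof.
  record _≈_ (a b : ℤ) : Set where
    constructor ≈-by
    field divides-difference : M ∣ₛ (a - b)

  ≈-reflexive : ∀ {a b} → a ≡ b → a ≈ b
  ≈-reflexive {a} refl = ≈-by (subst (M ∣ₛ_) (sym (+-inverseʳ a)) (divides 0ℤ refl))

  ≈-refl : ∀ {a} → a ≈ a
  ≈-refl = ≈-reflexive refl

  ≈-sym : ∀ {a b} → a ≈ b → b ≈ a
  ≈-sym {a} {b} (≈-by p) = ≈-by (subst (M ∣ₛ_) neg-diff (∣m⇒∣-m p))
    where neg-diff : - (a - b) ≡ b - a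
          neg-diff = solve (a ∷ b ∷ [])

  ≈-trans : ∀ {a b c} → a ≈ b → b ≈ c → a ≈ c
  ≈-trans {a} {b} {c} (≈-by p) (≈-by q) = ≈-by (subst (M ∣ₛ_) telescope (∣m∣n⇒∣m+n p q))
    where telescope : (a - b) + (b - c) ≡ a - c
          telescope = solve (a ∷ b ∷ c ∷ [])

  ≈-setoid : Setoid 0ℓ 0ℓ
  ≈-setoid = record
    { Carrier = ℤ ; _≈_ = _≈_
    ; isEquivalence = record { refl = ≈-refl ; sym = ≈-sym ; trans = ≈-trans } }

  module ≈-Reasoning = Relation.Binary.Reasoning.Setoid ≈-setoid

  +-cong : ∀ {a b c d} → a ≈ b → c ≈ d → a + c ≈ b + d
  +-cong {a} {b} {c} {d} (≈-by p) (≈-by q) = ≈-by (subst (M ∣ₛ_) regroup (∣m∣n⇒∣m+n p q))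
    where regroup : (a - b) + (c - d) ≡ (a + c) - (b + d)
          regroup = solve (a ∷ b ∷ c ∷ d ∷ [])

  -‿cong : ∀ {a b} → a ≈ b → - a ≈ - b
  -‿cong {a} {b} (≈-by p) = ≈-by (subst (M ∣ₛ_) neg-diff (∣m⇒∣-m p))
    where neg-diff : - (a - b) ≡ - a - - b
          neg-diff = solve (a ∷ b ∷ [])

  M≈0 : M ≈ 0ℤ
  M≈0 = ≈-by (subst (M ∣ₛ_) (sym (+-identityʳ M)) ∣ₛ.∣-refl)

  ≈⇒≈⊔ : ∀ {a b} → a ≈ b → a ≈ a ⊔ b
  ≈⇒≈⊔ {a} {b} a≈b with ⊔-sel a b
  ... | inj₁ a⊔b≡a = ≈-reflexive (sym a⊔b≡a)
  ... | inj₂ a⊔b≡b = ≈-trans a≈b (≈-reflexive (sym a⊔b≡b))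

  ≈-transpose : ∀ g l s → g + (l - s) ≈ 1ℤ → g ≈ (1ℤ - l) + s
  ≈-transpose g l s p = begin
    g                          ≡⟨ solve (g ∷ l ∷ s ∷ []) ⟩
    (g + (l - s)) + (s - l)    ≈⟨ +-cong p ≈-refl ⟩
    1ℤ + (s - l)               ≡⟨ solve (l ∷ s ∷ []) ⟩
    (1ℤ - l) + s               ∎
    where open ≈-Reasoning

  _≈?_ : ∀ a b → Dec (a ≈ b)
  a ≈? b = Dec.map′ ≈-by _≈_.divides-difference (M ∣ₛ.∣? (a - b))

module PhaseSpace (M : ℤ) where
  open Congruence M public

  data Fact : Set where
    ∅ full : Fact
    ⟨_⟩    : ℤ → Fact

  infixl 7 _·_
  infixl 6 _∩_
  infix 8 _ᗮ
  infix 4 _⊑_ _≋_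

  _·_ : Fact → Fact → Fact
  ∅     · _     = ∅
  full  · ∅     = ∅
  full  · _     = full
  ⟨ a ⟩ · ∅     = ∅
  ⟨ a ⟩ · full  = full
  ⟨ a ⟩ · ⟨ b ⟩ = ⟨ a + b ⟩

  _ᗮ : Fact → Fact
  ∅ ᗮ     = full
  full ᗮ  = ∅
  ⟨ a ⟩ ᗮ = ⟨ 1ℤ - a ⟩

  _∩_ : Fact → Fact → Fact
  ∅     ∩ _     = ∅
  full  ∩ Y     = Y
  ⟨ a ⟩ ∩ ∅     = ∅
  ⟨ a ⟩ ∩ full  = ⟨ a ⟩
  ⟨ a ⟩ ∩ ⟨ b ⟩ with a ≈? b
  ... | yes _ = ⟨ a ⟩
  ... | no _  = ∅

  data _⊑_ : Fact → Fact → Set where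
    ∅⊑    : ∀ {Y} → ∅ ⊑ Y
    ⊑full : ∀ {X} → X ⊑ full
    ⟨_⟩   : ∀ {a b} → a ≈ b → ⟨ a ⟩ ⊑ ⟨ b ⟩

  _⊆⊥ : Fact → Set
  X ⊆⊥ = X ⊑ ⟨ 1ℤ ⟩

  _≋_ : Fact → Fact → Set
  X ≋ Y = X ⊑ Y × Y ⊑ X

  ⊑-refl : ∀ {X} → X ⊑ X
  ⊑-refl {∅}     = ∅⊑
  ⊑-refl {full}  = ⊑full
  ⊑-refl {⟨ a ⟩} = ⟨ ≈-refl ⟩

  ⊑-reflexive : ∀ {X Y} → X ≡ Y → X ⊑ Y
  ⊑-reflexive refl = ⊑-refl

  ⊑-trans : ∀ {X Y Z} → X ⊑ Y → Y ⊑ Z → X ⊑ Z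
  ⊑-trans ∅⊑      _       = ∅⊑
  ⊑-trans _       ⊑full   = ⊑full
  ⊑-trans ⟨ p ⟩   ⟨ q ⟩   = ⟨ ≈-trans p q ⟩

  ≋-trans : ∀ {X Y Z} → X ≋ Y → Y ≋ Z → X ≋ Z
  ≋-trans (p , p′) (q , q′) = ⊑-trans p q , ⊑-trans q′ p′

  ≋-refl : ∀ {X} → X ≋ X
  ≋-refl = ⊑-refl , ⊑-refl

  ⟨⟩-cong : ∀ {a b} → a ≈ b → ⟨ a ⟩ ≋ ⟨ b ⟩
  ⟨⟩-cong p = ⟨ p ⟩ , ⟨ ≈-sym p ⟩

  ·-comm : ∀ X Y → X · Y ≡ Y · X
  ·-comm ∅     ∅     = refl
  ·-comm ∅     full  = refl
  ·-comm ∅     ⟨ _ ⟩ = refl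
  ·-comm full  ∅     = refl
  ·-comm full  full  = refl
  ·-comm full  ⟨ _ ⟩ = refl
  ·-comm ⟨ _ ⟩ ∅     = refl
  ·-comm ⟨ _ ⟩ full  = refl
  ·-comm ⟨ a ⟩ ⟨ b ⟩ = cong ⟨_⟩ (+-comm a b)

  ·-zeroʳ : ∀ X → X · ∅ ≡ ∅
  ·-zeroʳ ∅     = refl
  ·-zeroʳ full  = refl
  ·-zeroʳ ⟨ _ ⟩ = refl

  ·-assoc : ∀ X Y Z → (X · Y) · Z ≡ X · (Y · Z)
  ·-assoc ∅     _     _     = refl
  ·-assoc full  ∅     _     = refl
  ·-assoc full  full  ∅     = refl
  ·-assoc full  full  full  = refl
  ·-assoc full  full  ⟨ _ ⟩ = refl
  ·-assoc full  ⟨ _ ⟩ ∅     = refl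
  ·-assoc full  ⟨ _ ⟩ full  = refl
  ·-assoc full  ⟨ _ ⟩ ⟨ _ ⟩ = refl
  ·-assoc ⟨ _ ⟩ ∅     _     = refl
  ·-assoc ⟨ _ ⟩ full  ∅     = refl
  ·-assoc ⟨ _ ⟩ full  full  = refl
  ·-assoc ⟨ _ ⟩ full  ⟨ _ ⟩ = refl
  ·-assoc ⟨ _ ⟩ ⟨ _ ⟩ ∅     = refl
  ·-assoc ⟨ _ ⟩ ⟨ _ ⟩ full  = refl
  ·-assoc ⟨ a ⟩ ⟨ b ⟩ ⟨ c ⟩ = cong ⟨_⟩ (+-assoc a b c)

  ·-identityˡ : ∀ X → ⟨ 0ℤ ⟩ · X ≡ X
  ·-identityˡ ∅     = refl
  ·-identityˡ full  = refl
  ·-identityˡ ⟨ a ⟩ = cong ⟨_⟩ (+-identityˡ a)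

  ·-identityʳ : ∀ X → X · ⟨ 0ℤ ⟩ ≡ X
  ·-identityʳ X = trans (·-comm X ⟨ 0ℤ ⟩) (·-identityˡ X)

  ᗮ-involutive : ∀ X → X ᗮ ᗮ ≡ X
  ᗮ-involutive ∅     = refl
  ᗮ-involutive full  = refl
  ᗮ-involutive ⟨ a ⟩ = cong ⟨_⟩ (solve (a ∷ []))

  ·-mono : ∀ {X X′ Y Y′} → X ⊑ X′ → Y ⊑ Y′ → X · Y ⊑ X′ · Y′
  ·-mono ∅⊑            _     = ∅⊑
  ·-mono {X} ⊑full     ∅⊑    = ⊑-trans (⊑-reflexive (·-zeroʳ X)) ∅⊑
  ·-mono ⊑full         ⊑full = ⊑full
  ·-mono ⊑full         ⟨ _ ⟩ = ⊑full
  ·-mono ⟨ _ ⟩         ∅⊑    = ∅⊑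
  ·-mono ⟨ _ ⟩         ⊑full = ⊑full
  ·-mono ⟨ p ⟩         ⟨ q ⟩ = ⟨ +-cong p q ⟩

  ᗮ-antitone : ∀ {X Y} → X ⊑ Y → Y ᗮ ⊑ X ᗮ
  ᗮ-antitone ∅⊑    = ⊑full
  ᗮ-antitone ⊑full = ∅⊑
  ᗮ-antitone ⟨ p ⟩ = ⟨ +-cong (≈-refl {1ℤ}) (-‿cong (≈-sym p)) ⟩

  ·-⊆⊥⇒⊑ᗮ : ∀ X Y → (X · Y) ⊆⊥ → Y ⊑ X ᗮ
  ·-⊆⊥⇒⊑ᗮ ∅     _     _     = ⊑full
  ·-⊆⊥⇒⊑ᗮ full  ∅     _     = ∅⊑
  ·-⊆⊥⇒⊑ᗮ ⟨ _ ⟩ ∅     _     = ∅⊑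
  ·-⊆⊥⇒⊑ᗮ ⟨ a ⟩ ⟨ b ⟩ ⟨ p ⟩ = ⟨ begin
    b            ≡⟨ solve (a ∷ b ∷ []) ⟩
    (a + b) - a  ≈⟨ +-cong p ≈-refl ⟩
    1ℤ - a       ∎ ⟩
    where open ≈-Reasoning

  ⊑ᗮ⇒·-⊆⊥ : ∀ X Y → Y ⊑ X ᗮ → (X · Y) ⊆⊥
  ⊑ᗮ⇒·-⊆⊥ ∅     _     _     = ∅⊑
  ⊑ᗮ⇒·-⊆⊥ full  ∅     _     = ∅⊑
  ⊑ᗮ⇒·-⊆⊥ ⟨ _ ⟩ ∅     _     = ∅⊑
  ⊑ᗮ⇒·-⊆⊥ ⟨ a ⟩ ⟨ b ⟩ ⟨ p ⟩ = ⟨ begin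
    a + b         ≈⟨ +-cong (≈-refl {a}) p ⟩
    a + (1ℤ - a)  ≡⟨ solve (a ∷ []) ⟩
    1ℤ            ∎ ⟩
    where open ≈-Reasoning

  ∩-⊑ˡ : ∀ X Y → X ∩ Y ⊑ X
  ∩-⊑ˡ ∅     _     = ∅⊑
  ∩-⊑ˡ full  _     = ⊑full
  ∩-⊑ˡ ⟨ a ⟩ ∅     = ∅⊑
  ∩-⊑ˡ ⟨ a ⟩ full  = ⊑-refl
  ∩-⊑ˡ ⟨ a ⟩ ⟨ b ⟩ with a ≈? b
  ... | yes _ = ⊑-refl
  ... | no _  = ∅⊑

  ∩-⊑ʳ : ∀ X Y → X ∩ Y ⊑ Y
  ∩-⊑ʳ ∅     _     = ∅⊑
  ∩-⊑ʳ full  _     = ⊑-refl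
  ∩-⊑ʳ ⟨ a ⟩ ∅     = ∅⊑
  ∩-⊑ʳ ⟨ a ⟩ full  = ⊑full
  ∩-⊑ʳ ⟨ a ⟩ ⟨ b ⟩ with a ≈? b
  ... | yes a≈b = ⟨ a≈b ⟩
  ... | no _    = ∅⊑

  ⊑-∩ : ∀ {X Y Z} → Z ⊑ X → Z ⊑ Y → Z ⊑ X ∩ Y
  ⊑-∩ ∅⊑            _     = ∅⊑
  ⊑-∩ ⊑full         q     = q
  ⊑-∩ ⟨ p ⟩         ⊑full = ⟨ p ⟩
  ⊑-∩ {⟨ a ⟩} {⟨ b ⟩} ⟨ p ⟩ ⟨ q ⟩ with a ≈? b
  ... | yes _   = ⟨ p ⟩
  ... | no a≉b  = contradiction (≈-trans (≈-sym p) q) a≉b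

  ⊑⟨0⟩⇒⊑·self : ∀ {I} → I ⊑ ⟨ 0ℤ ⟩ → I ⊑ I · I
  ⊑⟨0⟩⇒⊑·self ∅⊑ = ∅⊑
  ⊑⟨0⟩⇒⊑·self {⟨ i ⟩} ⟨ p ⟩ = ⟨ begin
    i         ≡⟨ solve (i ∷ []) ⟩
    0ℤ + i    ≈⟨ +-cong (≈-sym p) ≈-refl ⟩
    i + i     ∎ ⟩
    where open ≈-Reasoning

  ·-leftComm : ∀ X Y Z → X · (Y · Z) ≡ Y · (X · Z)
  ·-leftComm X Y Z = begin
    X · (Y · Z)  ≡⟨ ·-assoc X Y Z ⟨
    (X · Y) · Z  ≡⟨ cong (_· Z) (·-comm X Y) ⟩
    (Y · X) · Z  ≡⟨ ·-assoc Y X Z ⟩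
    Y · (X · Z)  ∎
    where open ≡-Reasoning

  ·-interchange : ∀ W X Y Z → (W · X) · (Y · Z) ≡ (W · Y) · (X · Z)
  ·-interchange W X Y Z = begin
    (W · X) · (Y · Z)  ≡⟨ ·-assoc W X (Y · Z) ⟩
    W · (X · (Y · Z))  ≡⟨ cong (W ·_) (·-leftComm X Y Z) ⟩
    W · (Y · (X · Z))  ≡⟨ ·-assoc W Y (X · Z) ⟨
    (W · Y) · (X · Z)  ∎
    where open ≡-Reasoning

  ∏ : List Fact → Fact
  ∏ = foldr _·_ ⟨ 0ℤ ⟩

  ∏-++ : ∀ Xs Ys → ∏ (Xs ++ Ys) ≡ ∏ Xs · ∏ Ys
  ∏-++ []       Ys = sym (·-identityˡ (∏ Ys))
  ∏-++ (X ∷ Xs) Ys = trans (cong (X ·_) (∏-++ Xs Ys)) (sym (·-assoc X (∏ Xs) (∏ Ys)))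

  ∏-↭ : ∀ {Xs Ys} → Xs ↭ Ys → ∏ Xs ≡ ∏ Ys
  ∏-↭ ↭.refl          = refl
  ∏-↭ (↭.prep X p)     = cong (X ·_) (∏-↭ p)
  ∏-↭ (↭.swap X Y p)   = trans (cong (λ Z → X · (Y · Z)) (∏-↭ p)) (·-leftComm X Y _)
  ∏-↭ (↭.trans p q)    = trans (∏-↭ p) (∏-↭ q)

  -- Sequents and soundness

  ⟦_⟧ : Formula → Fact
  ⟦ lit _ ⟧ = ⟨ 0ℤ ⟩
  ⟦ ⊥′ ⟧    = ⟨ 1ℤ ⟩
  ⟦ 𝟙 ⟧     = ⟨ 0ℤ ⟩
  ⟦ ⊤′ ⟧    = full
  ⟦ 𝟘 ⟧     = ∅
  ⟦ A ⊗ B ⟧ = ⟦ A ⟧ · ⟦ B ⟧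
  ⟦ A ⅋ B ⟧ = (⟦ A ⟧ ᗮ · ⟦ B ⟧ ᗮ) ᗮ
  ⟦ A ⊸ B ⟧ = (⟦ A ⟧ · ⟦ B ⟧ ᗮ) ᗮ
  ⟦ A & B ⟧ = ⟦ A ⟧ ∩ ⟦ B ⟧
  ⟦ A ⊕ B ⟧ = (⟦ A ⟧ ᗮ ∩ ⟦ B ⟧ ᗮ) ᗮ
  ⟦ ! A ⟧   = ⟨ 0ℤ ⟩ ∩ ⟦ A ⟧
  ⟦ ¿ A ⟧   = (⟨ 0ℤ ⟩ ∩ ⟦ A ⟧ ᗮ) ᗮ

  ⟦_⟧ʳ : Formula → Fact
  ⟦ B ⟧ʳ = ⟦ B ⟧ ᗮ

  ⟦_⊩_⟧ : List Formula → List Formula → Fact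
  ⟦ Γ ⊩ Δ ⟧ = ∏ (map ⟦_⟧ Γ) · ∏ (map ⟦_⟧ʳ Δ)

  record Valid (Γ Δ : List Formula) : Set where
    constructor valid
    field holds : ⟦ Γ ⊩ Δ ⟧ ⊆⊥
  open Valid

  valid-≡ : ∀ {Γ Δ Γ′ Δ′} → ⟦ Γ ⊩ Δ ⟧ ≡ ⟦ Γ′ ⊩ Δ′ ⟧ → Valid Γ Δ → Valid Γ′ Δ′
  valid-≡ eq (valid v) = valid (subst _⊆⊥ eq v)

  ⊩-∷ˡ : ∀ A Γ Δ → ⟦ A ∷ Γ ⊩ Δ ⟧ ≡ ⟦ A ⟧ · ⟦ Γ ⊩ Δ ⟧
  ⊩-∷ˡ A Γ Δ = ·-assoc ⟦ A ⟧ _ _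

  ⊩-∷ʳ : ∀ B Γ Δ → ⟦ Γ ⊩ B ∷ Δ ⟧ ≡ ⟦ B ⟧ ᗮ · ⟦ Γ ⊩ Δ ⟧
  ⊩-∷ʳ B Γ Δ = ·-leftComm _ ⟦ B ⟧ʳ _

  ⊩-++ : ∀ Γ Γ′ Δ Δ′ → ⟦ Γ ++ Γ′ ⊩ Δ ++ Δ′ ⟧ ≡ ⟦ Γ ⊩ Δ ⟧ · ⟦ Γ′ ⊩ Δ′ ⟧
  ⊩-++ Γ Γ′ Δ Δ′ = begin
    ∏ (map ⟦_⟧ (Γ ++ Γ′)) · ∏ (map ⟦_⟧ʳ (Δ ++ Δ′))
      ≡⟨ cong₂ (λ Xs Ys → ∏ Xs · ∏ Ys) (map-++ ⟦_⟧ Γ Γ′) (map-++ ⟦_⟧ʳ Δ Δ′) ⟩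
    ∏ (map ⟦_⟧ Γ ++ map ⟦_⟧ Γ′) · ∏ (map ⟦_⟧ʳ Δ ++ map ⟦_⟧ʳ Δ′)
      ≡⟨ cong₂ _·_ (∏-++ (map ⟦_⟧ Γ) _) (∏-++ (map ⟦_⟧ʳ Δ) _) ⟩
    (∏ (map ⟦_⟧ Γ) · ∏ (map ⟦_⟧ Γ′)) · (∏ (map ⟦_⟧ʳ Δ) · ∏ (map ⟦_⟧ʳ Δ′))
      ≡⟨ ·-interchange _ _ _ _ ⟩
    ⟦ Γ ⊩ Δ ⟧ · ⟦ Γ′ ⊩ Δ′ ⟧ ∎
    where open ≡-Reasoning

  ⊩-↭ : ∀ {Γ Γ′ Δ Δ′} → Γ ↭ Γ′ → Δ ↭ Δ′ → ⟦ Γ ⊩ Δ ⟧ ≡ ⟦ Γ′ ⊩ Δ′ ⟧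
  ⊩-↭ p q = cong₂ _·_ (∏-↭ (↭.map⁺ ⟦_⟧ p)) (∏-↭ (↭.map⁺ ⟦_⟧ʳ q))

  ⊑-ᗮᗮ : ∀ {X Y} → X ⊑ Y → X ⊑ Y ᗮ ᗮ
  ⊑-ᗮᗮ {Y = Y} = subst (_ ⊑_) (sym (ᗮ-involutive Y))

  ⊑ᗮ-swap : ∀ {X Y} → Y ⊑ X ᗮ → X ⊑ Y ᗮ
  ⊑ᗮ-swap {X} p = subst (_⊑ _) (ᗮ-involutive X) (ᗮ-antitone p)

  ⊑ᗮ⇒valid-∷ˡ : ∀ {A Γ Δ} → ⟦ Γ ⊩ Δ ⟧ ⊑ ⟦ A ⟧ ᗮ → Valid (A ∷ Γ) Δ
  ⊑ᗮ⇒valid-∷ˡ {A} {Γ} {Δ} p = valid (subst _⊆⊥ (sym (⊩-∷ˡ A Γ Δ)) (⊑ᗮ⇒·-⊆⊥ ⟦ A ⟧ _ p))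

  valid-∷ˡ⇒⊑ᗮ : ∀ {A Γ Δ} → Valid (A ∷ Γ) Δ → ⟦ Γ ⊩ Δ ⟧ ⊑ ⟦ A ⟧ ᗮ
  valid-∷ˡ⇒⊑ᗮ {A} {Γ} {Δ} (valid v) = ·-⊆⊥⇒⊑ᗮ ⟦ A ⟧ _ (subst _⊆⊥ (⊩-∷ˡ A Γ Δ) v)

  ⊑⇒valid-∷ʳ : ∀ {B Γ Δ} → ⟦ Γ ⊩ Δ ⟧ ⊑ ⟦ B ⟧ → Valid Γ (B ∷ Δ)
  ⊑⇒valid-∷ʳ {B} {Γ} {Δ} p = valid (subst _⊆⊥ (sym (⊩-∷ʳ B Γ Δ)) (⊑ᗮ⇒·-⊆⊥ (⟦ B ⟧ ᗮ) _ (⊑-ᗮᗮ p)))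

  valid-∷ʳ⇒⊑ : ∀ {B Γ Δ} → Valid Γ (B ∷ Δ) → ⟦ Γ ⊩ Δ ⟧ ⊑ ⟦ B ⟧
  valid-∷ʳ⇒⊑ {B} {Γ} {Δ} (valid v) =
    subst (_ ⊑_) (ᗮ-involutive ⟦ B ⟧) (·-⊆⊥⇒⊑ᗮ (⟦ B ⟧ ᗮ) _ (subst _⊆⊥ (⊩-∷ʳ B Γ Δ) v))

  valid-∷ˡ-antitone : ∀ {A A′ Γ Δ} → ⟦ A ⟧ ⊑ ⟦ A′ ⟧ → Valid (A′ ∷ Γ) Δ → Valid (A ∷ Γ) Δ
  valid-∷ˡ-antitone A⊑A′ v = ⊑ᗮ⇒valid-∷ˡ (⊑-trans (valid-∷ˡ⇒⊑ᗮ v) (ᗮ-antitone A⊑A′))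

  valid-∷ʳ-mono : ∀ {B B′ Γ Δ} → ⟦ B ⟧ ⊑ ⟦ B′ ⟧ → Valid Γ (B ∷ Δ) → Valid Γ (B′ ∷ Δ)
  valid-∷ʳ-mono B⊑B′ v = ⊑⇒valid-∷ʳ (⊑-trans (valid-∷ʳ⇒⊑ v) B⊑B′)

  ⊩-++-⊑ : ∀ Γ Γ′ Δ Δ′ {X} → ⟦ Γ ⊩ Δ ⟧ · ⟦ Γ′ ⊩ Δ′ ⟧ ⊑ X → ⟦ Γ ++ Γ′ ⊩ Δ ++ Δ′ ⟧ ⊑ X
  ⊩-++-⊑ Γ Γ′ Δ Δ′ = subst (_⊑ _) (sym (⊩-++ Γ Γ′ Δ Δ′))

  ⊩-⊗ : ∀ A B Γ Δ → ⟦ A ⊗ B ∷ Γ ⊩ Δ ⟧ ≡ ⟦ A ∷ B ∷ Γ ⊩ Δ ⟧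
  ⊩-⊗ A B Γ Δ = cong (_· _) (·-assoc ⟦ A ⟧ ⟦ B ⟧ _)

  ⊩-⅋ : ∀ A B Γ Δ → ⟦ Γ ⊩ A ⅋ B ∷ Δ ⟧ ≡ ⟦ Γ ⊩ A ∷ B ∷ Δ ⟧
  ⊩-⅋ A B Γ Δ = begin
    ⟦ Γ ⊩ A ⅋ B ∷ Δ ⟧              ≡⟨ ⊩-∷ʳ (A ⅋ B) Γ Δ ⟩
    ⟦ A ⅋ B ⟧ ᗮ · ⟦ Γ ⊩ Δ ⟧        ≡⟨ cong (_· _) (ᗮ-involutive _) ⟩
    (⟦ A ⟧ ᗮ · ⟦ B ⟧ ᗮ) · ⟦ Γ ⊩ Δ ⟧ ≡⟨ ·-assoc _ _ _ ⟩
    ⟦ A ⟧ ᗮ · (⟦ B ⟧ ᗮ · ⟦ Γ ⊩ Δ ⟧) ≡⟨ cong (⟦ A ⟧ ᗮ ·_) (⊩-∷ʳ B Γ Δ) ⟨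
    ⟦ A ⟧ ᗮ · ⟦ Γ ⊩ B ∷ Δ ⟧        ≡⟨ ⊩-∷ʳ A Γ (B ∷ Δ) ⟨
    ⟦ Γ ⊩ A ∷ B ∷ Δ ⟧              ∎
    where open ≡-Reasoning

  ⊩-⊸ : ∀ A B Γ Δ → ⟦ Γ ⊩ A ⊸ B ∷ Δ ⟧ ≡ ⟦ A ∷ Γ ⊩ B ∷ Δ ⟧
  ⊩-⊸ A B Γ Δ = begin
    ⟦ Γ ⊩ A ⊸ B ∷ Δ ⟧            ≡⟨ ⊩-∷ʳ (A ⊸ B) Γ Δ ⟩
    ⟦ A ⊸ B ⟧ ᗮ · ⟦ Γ ⊩ Δ ⟧      ≡⟨ cong (_· _) (ᗮ-involutive _) ⟩
    (⟦ A ⟧ · ⟦ B ⟧ ᗮ) · ⟦ Γ ⊩ Δ ⟧ ≡⟨ ·-assoc _ _ _ ⟩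
    ⟦ A ⟧ · (⟦ B ⟧ ᗮ · ⟦ Γ ⊩ Δ ⟧) ≡⟨ cong (⟦ A ⟧ ·_) (⊩-∷ʳ B Γ Δ) ⟨
    ⟦ A ⟧ · ⟦ Γ ⊩ B ∷ Δ ⟧        ≡⟨ ⊩-∷ˡ A Γ (B ∷ Δ) ⟨
    ⟦ A ∷ Γ ⊩ B ∷ Δ ⟧            ∎
    where open ≡-Reasoning

  ¿ʳ-⊑⟨0⟩ : ∀ A → ⟦ ¿ A ⟧ʳ ⊑ ⟨ 0ℤ ⟩
  ¿ʳ-⊑⟨0⟩ A = subst (_⊑ _) (sym (ᗮ-involutive _)) (∩-⊑ˡ ⟨ 0ℤ ⟩ (⟦ A ⟧ ᗮ))

  !¿-context : ∀ Γ Δ → ⟦ map !_ Γ ⊩ map ¿_ Δ ⟧ ⊑ ⟨ 0ℤ ⟩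
  !¿-context Γ Δ = ·-mono (!-context Γ) (¿-context Δ)
    where
    !-context : ∀ Γ → ∏ (map ⟦_⟧ (map !_ Γ)) ⊑ ⟨ 0ℤ ⟩
    !-context []      = ⊑-refl
    !-context (A ∷ Γ) = ·-mono (∩-⊑ˡ ⟨ 0ℤ ⟩ ⟦ A ⟧) (!-context Γ)
    ¿-context : ∀ Δ → ∏ (map ⟦_⟧ʳ (map ¿_ Δ)) ⊑ ⟨ 0ℤ ⟩
    ¿-context []      = ⊑-refl
    ¿-context (A ∷ Δ) = ·-mono (¿ʳ-⊑⟨0⟩ A) (¿-context Δ)

  weaken : ∀ {I X} → I ⊑ ⟨ 0ℤ ⟩ → X ⊆⊥ → (I · X) ⊆⊥
  weaken {X = X} i x = ⊑-trans (·-mono i ⊑-refl) (subst _⊆⊥ (sym (·-identityˡ X)) x)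

  contract : ∀ {I X} → I ⊑ ⟨ 0ℤ ⟩ → (I · (I · X)) ⊆⊥ → (I · X) ⊆⊥
  contract {I} {X} i v = ⊑-trans (·-mono (⊑⟨0⟩⇒⊑·self i) ⊑-refl) (subst _⊆⊥ (sym (·-assoc I I X)) v)

  weaken-∷ˡ : ∀ {A Γ Δ} → ⟦ A ⟧ ⊑ ⟨ 0ℤ ⟩ → Valid Γ Δ → Valid (A ∷ Γ) Δ
  weaken-∷ˡ {A} {Γ} {Δ} i (valid v) = valid (subst _⊆⊥ (sym (⊩-∷ˡ A Γ Δ)) (weaken i v))

  weaken-∷ʳ : ∀ {B Γ Δ} → ⟦ B ⟧ʳ ⊑ ⟨ 0ℤ ⟩ → Valid Γ Δ → Valid Γ (B ∷ Δ)
  weaken-∷ʳ {B} {Γ} {Δ} i (valid v) = valid (subst _⊆⊥ (sym (⊩-∷ʳ B Γ Δ)) (weaken i v))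

  contract-∷ˡ : ∀ {A Γ Δ} → ⟦ A ⟧ ⊑ ⟨ 0ℤ ⟩ → Valid (A ∷ A ∷ Γ) Δ → Valid (A ∷ Γ) Δ
  contract-∷ˡ {A} {Γ} {Δ} i (valid v) =
    valid (subst _⊆⊥ (sym (⊩-∷ˡ A Γ Δ))
      (contract i (subst _⊆⊥ (trans (⊩-∷ˡ A (A ∷ Γ) Δ) (cong (⟦ A ⟧ ·_) (⊩-∷ˡ A Γ Δ))) v)))

  contract-∷ʳ : ∀ {B Γ Δ} → ⟦ B ⟧ʳ ⊑ ⟨ 0ℤ ⟩ → Valid Γ (B ∷ B ∷ Δ) → Valid Γ (B ∷ Δ)
  contract-∷ʳ {B} {Γ} {Δ} i (valid v) =
    valid (subst _⊆⊥ (sym (⊩-∷ʳ B Γ Δ))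
      (contract i (subst _⊆⊥ (trans (⊩-∷ʳ B Γ (B ∷ Δ)) (cong (⟦ B ⟧ʳ ·_) (⊩-∷ʳ B Γ Δ))) v)))

  sound : ∀ {Γ Δ} → Γ ⊢ Δ → Valid Γ Δ
  sound (ax {A}) = ⊑⇒valid-∷ʳ (⊑-reflexive (trans (·-identityʳ _) (·-identityʳ ⟦ A ⟧)))
  sound (cut {Γ} {Γ′} {Δ} {Δ′} {A} d e) =
    valid (⊑-trans (⊩-++-⊑ Γ Γ′ Δ Δ′ (·-mono (valid-∷ʳ⇒⊑ (sound d)) (valid-∷ˡ⇒⊑ᗮ (sound e))))
                   (⊑ᗮ⇒·-⊆⊥ ⟦ A ⟧ _ ⊑-refl))
  sound (exch p q d) = valid-≡ (⊩-↭ p q) (sound d)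
  sound ⊥L = valid ⊑-refl
  sound (⊥R d) = ⊑⇒valid-∷ʳ (holds (sound d))
  sound (𝟙L d) = ⊑ᗮ⇒valid-∷ˡ (holds (sound d))
  sound 𝟙R = valid ⊑-refl
  sound ⊤R = ⊑⇒valid-∷ʳ ⊑full
  sound 𝟘L = ⊑ᗮ⇒valid-∷ˡ ⊑full
  sound (⊗L {Γ} {Δ} {A} {B} d) = valid-≡ (sym (⊩-⊗ A B Γ Δ)) (sound d)
  sound (⊗R {Γ} {Γ′} {Δ} {Δ′} d e) =
    ⊑⇒valid-∷ʳ (⊩-++-⊑ Γ Γ′ Δ Δ′ (·-mono (valid-∷ʳ⇒⊑ (sound d)) (valid-∷ʳ⇒⊑ (sound e))))
  sound (⅋L {Γ} {Γ′} {Δ} {Δ′} d e) =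
    ⊑ᗮ⇒valid-∷ˡ (⊩-++-⊑ Γ Γ′ Δ Δ′ (⊑-ᗮᗮ (·-mono (valid-∷ˡ⇒⊑ᗮ (sound d)) (valid-∷ˡ⇒⊑ᗮ (sound e)))))
  sound (⅋R {Γ} {Δ} {A} {B} d) = valid-≡ (sym (⊩-⅋ A B Γ Δ)) (sound d)
  sound (⊸L {Γ} {Γ′} {Δ} {Δ′} d e) =
    ⊑ᗮ⇒valid-∷ˡ (⊩-++-⊑ Γ Γ′ Δ Δ′ (⊑-ᗮᗮ (·-mono (valid-∷ʳ⇒⊑ (sound d)) (valid-∷ˡ⇒⊑ᗮ (sound e)))))
  sound (⊸R {Γ} {Δ} {A} {B} d) = valid-≡ (sym (⊩-⊸ A B Γ Δ)) (sound d)
  sound (&L₁ {A = A} {B} d) = valid-∷ˡ-antitone (∩-⊑ˡ ⟦ A ⟧ ⟦ B ⟧) (sound d)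
  sound (&L₂ {A = A} {B} d) = valid-∷ˡ-antitone (∩-⊑ʳ ⟦ A ⟧ ⟦ B ⟧) (sound d)
  sound (&R d e) = ⊑⇒valid-∷ʳ (⊑-∩ (valid-∷ʳ⇒⊑ (sound d)) (valid-∷ʳ⇒⊑ (sound e)))
  sound (⊕L d e) = ⊑ᗮ⇒valid-∷ˡ (⊑-ᗮᗮ (⊑-∩ (valid-∷ˡ⇒⊑ᗮ (sound d)) (valid-∷ˡ⇒⊑ᗮ (sound e))))
  sound (⊕R₁ {A = A} {B} d) = valid-∷ʳ-mono (⊑ᗮ-swap (∩-⊑ˡ (⟦ A ⟧ ᗮ) (⟦ B ⟧ ᗮ))) (sound d)
  sound (⊕R₂ {A = A} {B} d) = valid-∷ʳ-mono (⊑ᗮ-swap (∩-⊑ʳ (⟦ A ⟧ ᗮ) (⟦ B ⟧ ᗮ))) (sound d)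
  sound (!W {A = A} d) = weaken-∷ˡ (∩-⊑ˡ ⟨ 0ℤ ⟩ ⟦ A ⟧) (sound d)
  sound (!C {A = A} d) = contract-∷ˡ (∩-⊑ˡ ⟨ 0ℤ ⟩ ⟦ A ⟧) (sound d)
  sound (!D {A = A} d) = valid-∷ˡ-antitone (∩-⊑ʳ ⟨ 0ℤ ⟩ ⟦ A ⟧) (sound d)
  sound (!R {Γ} {Δ} d) = ⊑⇒valid-∷ʳ (⊑-∩ (!¿-context Γ Δ) (valid-∷ʳ⇒⊑ (sound d)))
  sound (¿W {A = A} d) = weaken-∷ʳ (¿ʳ-⊑⟨0⟩ A) (sound d)
  sound (¿C {A = A} d) = contract-∷ʳ (¿ʳ-⊑⟨0⟩ A) (sound d)
  sound (¿D {A = A} d) = valid-∷ʳ-mono (⊑ᗮ-swap (∩-⊑ʳ ⟨ 0ℤ ⟩ (⟦ A ⟧ ᗮ))) (sound d)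
  sound (¿L {Γ} {Δ} d) = ⊑ᗮ⇒valid-∷ˡ (⊑-ᗮᗮ (⊑-∩ (!¿-context Γ Δ) (valid-∷ˡ⇒⊑ᗮ (sound d))))


  -- Formulas denoting a single point

  ≋-reflexive : ∀ {X Y} → X ≡ Y → X ≋ Y
  ≋-reflexive refl = ≋-refl

  ·-cong : ∀ {X X′ Y Y′} → X ≋ X′ → Y ≋ Y′ → X · Y ≋ X′ · Y′
  ·-cong (p , p′) (q , q′) = ·-mono p q , ·-mono p′ q′

  ᗮ-cong : ∀ {X Y} → X ≋ Y → X ᗮ ≋ Y ᗮ
  ᗮ-cong (p , p′) = ᗮ-antitone p′ , ᗮ-antitone p

  ∩-≋-⟨⟩ : ∀ {X Y a b} → X ≋ ⟨ a ⟩ → Y ≋ ⟨ b ⟩ → a ≈ b → X ∩ Y ≋ ⟨ a ⟩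
  ∩-≋-⟨⟩ {X} {Y} (x , x′) (_ , y′) a≈b = ⊑-trans (∩-⊑ˡ X Y) x , ⊑-∩ x′ (⊑-trans ⟨ a≈b ⟩ y′)

  ⟦⊸⟧-point : ∀ A B {a b} → ⟦ A ⟧ ≋ ⟨ a ⟩ → ⟦ B ⟧ ≋ ⟨ b ⟩ → ⟦ A ⊸ B ⟧ ≋ ⟨ b - a ⟩
  ⟦⊸⟧-point A B {a} {b} p q =
    ≋-trans (ᗮ-cong (·-cong p (ᗮ-cong q))) (⟨⟩-cong (≈-reflexive residual))
    where residual : 1ℤ - (a + (1ℤ - b)) ≡ b - a
          residual = solve (a ∷ b ∷ [])

  ⟦&⟧-point : ∀ A B {a b} → ⟦ A ⟧ ≋ ⟨ a ⟩ → ⟦ B ⟧ ≋ ⟨ b ⟩ → a ≈ b → ⟦ A & B ⟧ ≋ ⟨ a ⟩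
  ⟦&⟧-point A B = ∩-≋-⟨⟩

  ⟦⊕⟧-point : ∀ A B {a b} → ⟦ A ⟧ ≋ ⟨ a ⟩ → ⟦ B ⟧ ≋ ⟨ b ⟩ → a ≈ b → ⟦ A ⊕ B ⟧ ≋ ⟨ a ⟩
  ⟦⊕⟧-point A B {a} p q a≈b =
    ≋-trans (ᗮ-cong (∩-≋-⟨⟩ (ᗮ-cong p) (ᗮ-cong q) (+-cong (≈-refl {1ℤ}) (-‿cong a≈b))))
            (≋-reflexive (ᗮ-involutive ⟨ a ⟩))

  ⟦!⟧-point : ∀ A → ⟦ A ⟧ ≋ ⟨ 0ℤ ⟩ → ⟦ ! A ⟧ ≋ ⟨ 0ℤ ⟩
  ⟦!⟧-point A p = ∩-≋-⟨⟩ ≋-refl p ≈-refl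

  ⟦⟧-constant : ∀ {A} → IsConstant A → ⟦ A ⟧ ≋ ⟨ #⊥ A ⟩
  ⟦⟧-constant ⊥ᶜ               = ≋-refl
  ⟦⟧-constant 𝟙ᶜ               = ≋-refl
  ⟦⟧-constant (a ⊗ᶜ b)         = ·-cong (⟦⟧-constant a) (⟦⟧-constant b)
  ⟦⟧-constant (_⊸ᶜ_ {A} {B} a b) = ⟦⊸⟧-point A B (⟦⟧-constant a) (⟦⟧-constant b)

  DenotesCount : Formula → Set
  DenotesCount A = ⟦ A ⟧ ≋ ⟨ #⊥ A ⟩

  ∏-count : ∀ {Γ} → All DenotesCount Γ → ∏ (map ⟦_⟧ Γ) ≋ ⟨ Σ#⊥ Γ ⟩
  ∏-count All.[]       = ≋-refl
  ∏-count (p All.∷ ps) = ·-cong p (∏-count ps)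

  ∏-neutral : ∀ {Γ} → All (λ A → ⟦ A ⟧ ≋ ⟨ 0ℤ ⟩) Γ → ∏ (map ⟦_⟧ Γ) ≋ ⟨ 0ℤ ⟩
  ∏-neutral All.[]       = ≋-refl
  ∏-neutral (p All.∷ ps) = ·-cong p (∏-neutral ps)

  ∏ʳ-count : ∀ {Δ} → All DenotesCount Δ → ∏ (map ⟦_⟧ʳ Δ) ≋ ⟨ + length Δ - Σ#⊥ Δ ⟩
  ∏ʳ-count All.[]                 = ≋-refl
  ∏ʳ-count {B ∷ Δ} (p All.∷ ps) =
    ≋-trans (·-cong (ᗮ-cong p) (∏ʳ-count ps))
            (⟨⟩-cong (≈-reflexive (regroup (#⊥ B) (+ length Δ) (Σ#⊥ Δ))))
    where regroup : ∀ b n s → (1ℤ - b) + (n - s) ≡ (1ℤ + n) - (b + s)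
          regroup = solve-∀

  valid-point⇒≈1 : ∀ {Γ Δ z} → Valid Γ Δ → ⟦ Γ ⊩ Δ ⟧ ≋ ⟨ z ⟩ → z ≈ 1ℤ
  valid-point⇒≈1 (valid v) (_ , z⊑) with ⊑-trans z⊑ v
  ... | ⟨ z≈1 ⟩ = z≈1

  #⊥-congruence : ∀ Γ Γ₀ Δ → All DenotesCount Γ → All (λ A → ⟦ A ⟧ ≋ ⟨ 0ℤ ⟩) Γ₀ →
                  All DenotesCount Δ → Γ ++ Γ₀ ⊢ Δ → Σ#⊥ Γ ≈ (1ℤ - + length Δ) + Σ#⊥ Δ
  #⊥-congruence Γ Γ₀ Δ γ γ₀ δ d =
    ≈-transpose (Σ#⊥ Γ) (+ length Δ) (Σ#⊥ Δ) (valid-point⇒≈1 (sound d) point)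
    where
    split : ⟦ Γ ++ Γ₀ ⊩ Δ ⟧ ≡ (∏ (map ⟦_⟧ Γ) · ∏ (map ⟦_⟧ Γ₀)) · ∏ (map ⟦_⟧ʳ Δ)
    split = cong (_· _) (trans (cong ∏ (map-++ ⟦_⟧ Γ Γ₀)) (∏-++ (map ⟦_⟧ Γ) _))
    point : ⟦ Γ ++ Γ₀ ⊩ Δ ⟧ ≋ ⟨ Σ#⊥ Γ + (+ length Δ - Σ#⊥ Δ) ⟩
    point = ≋-trans (≋-reflexive split)
              (·-cong (≋-trans (·-cong (∏-count γ) (∏-neutral γ₀)) (≋-reflexive (·-identityʳ ⟨ Σ#⊥ Γ ⟩)))
                      (∏ʳ-count δ))

#⊥-^⊗ : ∀ A n → #⊥ (A ^⊗ n) ≡ + n * #⊥ A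
#⊥-^⊗ A zero          = refl
#⊥-^⊗ A (suc zero)    = sym (*-identityˡ (#⊥ A))
#⊥-^⊗ A (suc (suc n)) =
  trans (cong (_+_ (#⊥ A)) (#⊥-^⊗ A (suc n)))
        (sym (trans (*-distribʳ-+ (#⊥ A) 1ℤ (+ suc n))
                    (cong (_+ + suc n * #⊥ A) (*-identityˡ (#⊥ A)))))

#⊥-⊥^⊗ : ∀ n → #⊥ (⊥′ ^⊗ n) ≡ + n
#⊥-⊥^⊗ n = trans (#⊥-^⊗ ⊥′ n) (*-identityʳ (+ n))

#⊥-⊸⊸ : ∀ A B → #⊥ ((A ⊸ B) ⊸ B) ≡ #⊥ A
#⊥-⊸⊸ A B = cancel (#⊥ A) (#⊥ B)
  where cancel : ∀ a b → b - (b - a) ≡ a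
        cancel = solve-∀

^⊗-constant : ∀ {A} → IsConstant A → ∀ n → IsConstant (A ^⊗ n)
^⊗-constant a zero          = 𝟙ᶜ
^⊗-constant a (suc zero)    = a
^⊗-constant a (suc (suc n)) = a ⊗ᶜ ^⊗-constant a (suc n)

module EncodingCounts (N p : ℕ) where
  open Encoding N p

  #⊥-H₀₀ : #⊥ H₀₀ ≡ - + N
  #⊥-H₀₀ = begin
    #⊥ (⊥′ ^⊗ 2) - #⊥ (⊥′ ^⊗ (N ℕ.+ 2))  ≡⟨ cong₂ _-_ (#⊥-⊥^⊗ 2) (#⊥-⊥^⊗ (N ℕ.+ 2)) ⟩
    + 2 - + (N ℕ.+ 2)                   ≡⟨ cong (λ k → + 2 - k) (pos-+ N 2) ⟩
    + 2 - (+ N + + 2)                   ≡⟨ cancel (+ N) ⟩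
    - + N                               ∎
    where open ≡-Reasoning
          cancel : ∀ n → + 2 - (n + + 2) ≡ - n
          cancel = solve-∀

  #⊥-H₁ : #⊥ H₁ ≡ + (9 ℕ.* N)
  #⊥-H₁ = begin
    #⊥ (⊥′ ^⊗ N) - #⊥ (C₀₀ ^⊗ 4)           ≡⟨ cong₂ _-_ (#⊥-⊥^⊗ N) (#⊥-^⊗ C₀₀ 4) ⟩
    + N - + 4 * #⊥ C₀₀                     ≡⟨ cong (λ c → + N - + 4 * c) #⊥-C₀₀ ⟩
    + N - + 4 * (+ 2 * - + N)              ≡⟨ collect (+ N) ⟩
    + 9 * + N                              ≡⟨ pos-* 9 N ⟨
    + (9 ℕ.* N)                            ∎
    where open ≡-Reasoning
          #⊥-C₀₀ : #⊥ C₀₀ ≡ + 2 * - + N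
          #⊥-C₀₀ = trans (#⊥-⊸⊸ (H₀₀ ^⊗ 2) (⊥′ ^⊗ 3)) (trans (#⊥-^⊗ H₀₀ 2) (cong (+ 2 *_) #⊥-H₀₀))
          collect : ∀ n → n - + 4 * (+ 2 * - n) ≡ + 9 * n
          collect = solve-∀

  #⊥-Dlit : ∀ m → #⊥ (Dlit m) ≡ + (9 ℕ.* N)
  #⊥-Dlit m = trans (#⊥-⊸⊸ H₁ (⊥′ ^⊗ (m ℕ.+ 4))) #⊥-H₁

  E-constant : ∀ X → IsConstant (E X)
  E-constant (q List⁺.∷ qs) = ^⊗-constant C₀₀-constant 6 ⊗ᶜ ⊗ˡ-constant q qs
    where
    H₀₀-constant : IsConstant H₀₀
    H₀₀-constant = ^⊗-constant ⊥ᶜ _ ⊸ᶜ ^⊗-constant ⊥ᶜ _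
    C₀₀-constant : IsConstant C₀₀
    C₀₀-constant = (^⊗-constant H₀₀-constant 2 ⊸ᶜ ^⊗-constant ⊥ᶜ 3) ⊸ᶜ ^⊗-constant ⊥ᶜ 3
    H₁-constant : IsConstant H₁
    H₁-constant = ^⊗-constant C₀₀-constant 4 ⊸ᶜ ^⊗-constant ⊥ᶜ N
    Dlit-constant : ∀ m → IsConstant (Dlit m)
    Dlit-constant m = (H₁-constant ⊸ᶜ ^⊗-constant ⊥ᶜ _) ⊸ᶜ ^⊗-constant ⊥ᶜ _
    ⊗ˡ-constant : ∀ q qs → IsConstant (⊗ˡ (Dlit q) (map Dlit qs))
    ⊗ˡ-constant q []       = Dlit-constant q
    ⊗ˡ-constant q (r ∷ rs) = Dlit-constant q ⊗ᶜ ⊗ˡ-constant r rs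

module EncodingSemantics (N p : ℕ) where
  open Encoding N p
  open EncodingCounts N p
  open PhaseSpace (+ (9 ℕ.* N))

  countE : ℤ
  countE = #⊥ (C₀₀ ^⊗ 6)

  #⊥-E : ∀ X → #⊥ (E X) ≈ countE
  #⊥-E (q List⁺.∷ qs) =
    ≈-trans (+-cong (≈-refl {countE}) (#⊥-⊗ˡ q qs)) (≈-reflexive (+-identityʳ countE))
    where
    #⊥-Dlit≈0 : ∀ m → #⊥ (Dlit m) ≈ 0ℤ
    #⊥-Dlit≈0 m = ≈-trans (≈-reflexive (#⊥-Dlit m)) M≈0
    #⊥-⊗ˡ : ∀ q qs → #⊥ (⊗ˡ (Dlit q) (map Dlit qs)) ≈ 0ℤ
    #⊥-⊗ˡ q []       = #⊥-Dlit≈0 q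
    #⊥-⊗ˡ q (r ∷ rs) = +-cong (#⊥-Dlit≈0 q) (#⊥-⊗ˡ r rs)

  ⟦E⟧ : ∀ X → ⟦ E X ⟧ ≋ ⟨ countE ⟩
  ⟦E⟧ X = ≋-trans (⟦⟧-constant (E-constant X)) (⟨⟩-cong (#⊥-E X))

  ⟦E⊸E⟧ : ∀ X Y → ⟦ E X ⊸ E Y ⟧ ≋ ⟨ 0ℤ ⟩
  ⟦E⊸E⟧ X Y =
    ≋-trans (⟦⊸⟧-point (E X) (E Y) (⟦E⟧ X) (⟦E⟧ Y)) (⟨⟩-cong (≈-reflexive (+-inverseʳ countE)))

  ⟦F⟧ : ∀ G → ⟦ F G ⟧ ≋ ⟨ 0ℤ ⟩
  ⟦F⟧ (imp X Y) = ⟦E⊸E⟧ (p ⊗ₛ X) (p ⊗ₛ Y)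
  ⟦F⟧ (impOr X Y₁ Y₂) =
    ≋-trans (⟦⊸⟧-point (Ep X) (Ep Y₁ ⊕ Ep Y₂) (⟦E⟧ (p ⊗ₛ X))
              (⟦⊕⟧-point (Ep Y₁) (Ep Y₂) (⟦E⟧ (p ⊗ₛ Y₁)) (⟦E⟧ (p ⊗ₛ Y₂)) ≈-refl))
            (⟨⟩-cong (≈-reflexive (+-inverseʳ countE)))
  ⟦F⟧ (with2 X₁ Y₁ X₂ Y₂) =
    ⟦&⟧-point (Ep X₁ ⊸ Ep Y₁) (Ep X₂ ⊸ Ep Y₂)
      (⟦E⊸E⟧ (p ⊗ₛ X₁) (p ⊗ₛ Y₁)) (⟦E⊸E⟧ (p ⊗ₛ X₂) (p ⊗ₛ Y₂)) ≈-refl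
  ⟦F⟧ (impImp U V Y) =
    ⟦⊸⟧-point (Ep U ⊸ Ep V) (E₀ ⊸ Ep Y) (⟦E⊸E⟧ (p ⊗ₛ U) (p ⊗ₛ V)) (⟦E⊸E⟧ (p List⁺.∷ []) (p ⊗ₛ Y))

  ⟦E⊕E⟧ : ∀ Y₁ Y₂ → DenotesCount (E Y₁ ⊕ E Y₂)
  ⟦E⊕E⟧ Y₁ Y₂ =
    ≋-trans (⟦⊕⟧-point (E Y₁) (E Y₂) (⟦⟧-constant (E-constant Y₁)) (⟦⟧-constant (E-constant Y₂))
                       E₁≈E₂)
            (⟨⟩-cong (≈⇒≈⊔ E₁≈E₂))
    where E₁≈E₂ : #⊥ (E Y₁) ≈ #⊥ (E Y₂)
          E₁≈E₂ = ≈-trans (#⊥-E Y₁) (≈-sym (#⊥-E Y₂))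

lemma4p4 : (N p : ℕ) → InRange N p →
    (Γ Δ : List NormFormula) → All (NFInRange N) Γ → All (NFInRange N) Δ →
    (As : List Formula) → All BotFormula As →
    (extra : List (SimpleProduct × SimpleProduct)) → length extra ≤ 1 →
    All (λ { (Y₁ , Y₂) → SPInRange N Y₁ × SPInRange N Y₂ }) extra →
    (Bs : List Formula) → All BotFormula Bs →
    let open Encoding N p in
    (As ++ map (λ { (Y₁ , Y₂) → E Y₁ ⊕ E Y₂ }) extra ++ map F Γ ++ map (λ G → ! F G) Δ) ⊢ Bs →
    + (9 ℕ.* N) ∣ (Σ#⊥ (As ++ map (λ { (Y₁ , Y₂) → E Y₁ ⊕ E Y₂ }) extra)
                    - ((+ 1 - + length Bs) ℤ.+ Σ#⊥ Bs))
lemma4p4 N p _ Γ Δ _ _ As As⊥ extra _ _ Bs Bs⊥ d =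
  ∣⇒∣ᵤ (_≈_.divides-difference
    (#⊥-congruence (As ++ _) (map F Γ ++ map (λ G → ! F G) Δ) Bs
      (++⁺ (constants As⊥) (map⁺ (All.universal (λ { (Y₁ , Y₂) → ⟦E⊕E⟧ Y₁ Y₂ }) extra)))
      (++⁺ (map⁺ (All.universal ⟦F⟧ Γ)) (map⁺ (All.universal (λ G → ⟦!⟧-point (F G) (⟦F⟧ G)) Δ)))
      (constants Bs⊥)
      (subst (_⊢ Bs) (sym (++-assoc As _ _)) d)))
  where
  open Encoding N p
  open PhaseSpace (+ (9 ℕ.* N))
  open EncodingSemantics N p
  constants : ∀ {Cs} → All BotFormula Cs → All DenotesCount Cs
  constants = All.map (⟦⟧-constant ∘ BotFormula⇒IsConstant)
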